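{- Let $q$ be a power of $2$, $C\in\mathbb{F}_q$ and $D\in\mathbb{F}_{q^2}$. Then the map $f:\mathbb{F}_{q^4}\to\mathbb{F}_{q^4}$, $$f(x)=Cx+Dx^q+(C+1)x^{q^2}+Dx^{q^3},$$ is an involution of $\mathbb{F}_{q^4}$, i.e. $f(f(x))=x$ for all $x\in\mathbb{F}_{q^4}$. -}

module Defs where

open import Level using (Level; _⊔_)
open import Data.Nat using (ℕ)
open import Data.Fin using (Fin)
open import Data.Product using (Σ; ∃; _×_)
open import Relation.Nullary using (¬_)
open import Relation.Binary.PropositionalEquality using (_≡_)
open import Algebra.Bundles using (CommutativeRing)

IsField : ∀ {c ℓ} → CommutativeRing c ℓ → Set (c ⊔ ℓ)
IsField R = ¬ (0# ≈ 1#) × (∀ x → ¬ (x ≈ 0#) → ∃ λ y → x * y ≈ 1#)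
  where open CommutativeRing R

HasCardinality : ∀ {c ℓ} → ℕ → CommutativeRing c ℓ → Set (c ⊔ ℓ)
HasCardinality n R =
  Σ (Fin n → Carrier) λ e →
    (∀ i j → e i ≈ e j → i ≡ j) × (∀ x → ∃ λ i → e i ≈ x)
  where open CommutativeRing R

module Pow {c ℓ} (R : CommutativeRing c ℓ) where
  open import Algebra.Bundles using (Semiring)
  open Semiring (CommutativeRing.semiring R) using (rawSemiring)
  open import Algebra.Definitions.RawSemiring rawSemiring public using (_^_)

invMap : ∀ {c ℓ} (R : CommutativeRing c ℓ) → ℕ →
         CommutativeRing.Carrier R → CommutativeRing.Carrier R →
         CommutativeRing.Carrier R → CommutativeRing.Carrier R
invMap R q C D x =
  C * x + D * (x ^ q) + (C + 1#) * (x ^ (q Data.Nat.* q))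
    + D * (x ^ (q Data.Nat.* q Data.Nat.* q))
  where open CommutativeRing R
        open Pow R
        import Data.Nat

module Submission where

-- A finite field with n = q⁴ = 2^(4(k+1)) elements has characteristic 2 (n · 1 = 0 because the sum of
-- all elements is invariant under x ↦ x + 1) and satisfies xⁿ = x, so σ x = x^q is a ring
-- endomorphism with σ⁴ = id.  Then f = C + D σ + (C+1) σ² + D σ³ is σ-semilinear, and as σ fixes C
-- and σ² fixes D, the powers σⁱ ∘ f only involve the coefficients C, D, σ D.  Expanding f ∘ f
-- gives x plus twice a linear combination of x, σ x, σ² x, σ³ x, i.e. x in characteristic 2.

open import Defs
open import Data.Nat using (ℕ; suc)
import Data.Nat as ℕ
import Data.Nat.Properties as ℕ
open import Data.Nat.GeneralisedArithmetic using (iterate)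
open import Data.Fin using (Fin; punchIn)
import Data.Fin as Fin
open import Data.Fin.Properties using (punchInᵢ≢i; nonZeroIndex) renaming (_≟_ to _≟ᶠ_)
open import Data.Fin.Permutation using (Permutation; permutation)
open import Data.Product using (∃; _,_; proj₁; proj₂)
open import Data.Empty using (⊥-elim)
open import Function using (_∘_)
open import Relation.Nullary using (¬_; Dec; yes; no)
import Relation.Binary.PropositionalEquality as ≡
open ≡ using (_≡_; _≢_)
open import Algebra.Bundles using (CommutativeRing; CommutativeMonoid)
import Algebra.Properties.CommutativeMonoid.Sum as Sum
import Algebra.Solver.Ring.NaturalCoefficients.Default as NatCoefficientSolver
import Relation.Binary.Reasoning.Setoid as SetoidReasoning

module _ {a ℓ} (M : CommutativeMonoid a ℓ) where
  open CommutativeMonoid M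
  open Sum M using (sum; sum-remove; sum-cong-≋)
  open SetoidReasoning setoid

  sum-differAt : ∀ {n} (f g : Fin n → Carrier) (z : Fin n) x →
                 f z ≈ x ∙ g z → (∀ i → i ≢ z → f i ≈ g i) → sum f ≈ x ∙ sum g
  sum-differAt {ℕ.zero} f g () x fz≈xgz f≈g
  sum-differAt {suc n} f g z x fz≈xgz f≈g = begin
    sum f                            ≈⟨ sum-remove {i = z} f ⟩
    f z ∙ sum (f ∘ punchIn z)        ≈⟨ ∙-cong fz≈xgz (sum-cong-≋ (λ j → f≈g _ (punchInᵢ≢i z j))) ⟩
    (x ∙ g z) ∙ sum (g ∘ punchIn z)  ≈⟨ assoc x (g z) _ ⟩
    x ∙ (g z ∙ sum (g ∘ punchIn z))  ≈⟨ ∙-congˡ (sum-remove {i = z} g) ⟨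
    x ∙ sum g                        ∎

module _ {c ℓ} (R : CommutativeRing c ℓ) where
  open CommutativeRing R
  open import Algebra.Properties.Ring ring using (+-identityʳ-unique)
  open import Algebra.Properties.CommutativeSemiring.Exp commutativeSemiring
  open import Algebra.Definitions.RawMonoid +-rawMonoid using (_×_)
  open import Algebra.Properties.Semiring.Mult semiring using (×1-homo-*)
  open Sum +-commutativeMonoid using (∑-distrib-+; sum-replicate; sum-permute; sum-cong-≋) renaming (sum to ∑)
  open Sum *-commutativeMonoid using () renaming (sum to ∏; ∑-distrib-+ to ∏-distrib-*; sum-replicate to ∏-replicate; sum-permute to ∏-permute; sum-cong-≋ to ∏-cong-≋)
  open NatCoefficientSolver commutativeSemiring using (solve; _:=_; _:+_; _:*_; con)
  open SetoidReasoning setoid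

  1#^n≈1# : ∀ n → 1# ^ n ≈ 1#
  1#^n≈1# ℕ.zero = refl
  1#^n≈1# (suc n) = trans (*-identityˡ _) (1#^n≈1# n)

  0#^n≈0# : ∀ n → .{{ℕ.NonZero n}} → 0# ^ n ≈ 0#
  0#^n≈0# (suc n) = zeroˡ _

  ∏-scale : ∀ {n} x (f : Fin n → Carrier) → ∏ (λ i → x * f i) ≈ x ^ n * ∏ f
  ∏-scale {n} x f = trans (∏-distrib-* (λ _ → x) f) (*-congʳ (∏-replicate n))

  iterate-^ : ∀ q j x → iterate (_^ q) x j ≈ x ^ (q ℕ.^ j)
  iterate-^ q ℕ.zero x = sym (*-identityʳ x)
  iterate-^ q (suc j) x = trans (iterate-^ q j (x ^ q)) (^-assocʳ x q (q ℕ.^ j))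

  module Field (isField : IsField R) where
    0#≉1# : ¬ (0# ≈ 1#)
    0#≉1# = proj₁ isField

    inverse : ∀ x → ¬ (x ≈ 0#) → ∃ λ y → x * y ≈ 1#
    inverse = proj₂ isField

    *-cancelʳ-nonZero : ∀ {p x y} → ¬ (p ≈ 0#) → x * p ≈ y * p → x ≈ y
    *-cancelʳ-nonZero {p} {x} {y} p≉0 xp≈yp with inverse p p≉0
    ... | p⁻¹ , pp⁻¹≈1 = begin
      x              ≈⟨ *-identityʳ x ⟨
      x * 1#         ≈⟨ *-congˡ pp⁻¹≈1 ⟨
      x * (p * p⁻¹)  ≈⟨ *-assoc x p p⁻¹ ⟨
      x * p * p⁻¹    ≈⟨ *-congʳ xp≈yp ⟩
      y * p * p⁻¹    ≈⟨ *-assoc y p p⁻¹ ⟩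
      y * (p * p⁻¹)  ≈⟨ *-congˡ pp⁻¹≈1 ⟩
      y * 1#         ≈⟨ *-identityʳ y ⟩
      y              ∎

    *-nonZero : ∀ {x y} → ¬ (x ≈ 0#) → ¬ (y ≈ 0#) → ¬ (x * y ≈ 0#)
    *-nonZero {x} {y} x≉0 y≉0 xy≈0 = y≉0 (*-cancelʳ-nonZero x≉0 (begin
      y * x   ≈⟨ *-comm y x ⟩
      x * y   ≈⟨ xy≈0 ⟩
      0#      ≈⟨ zeroˡ x ⟨
      0# * x  ∎))

    ∏-nonZero : ∀ {n} (f : Fin n → Carrier) → (∀ i → ¬ (f i ≈ 0#)) → ¬ (∏ f ≈ 0#)
    ∏-nonZero {ℕ.zero} f f≉0 = 0#≉1# ∘ sym
    ∏-nonZero {suc n} f f≉0 = *-nonZero (f≉0 Fin.zero) (∏-nonZero (f ∘ Fin.suc) (f≉0 ∘ Fin.suc))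

    2^j×1#≉0# : ¬ (1# + 1# ≈ 0#) → ∀ j → ¬ ((2 ℕ.^ j) × 1# ≈ 0#)
    2^j×1#≉0# 1+1≉0 ℕ.zero 1+0≈0 = 0#≉1# (sym (trans (sym (+-identityʳ 1#)) 1+0≈0))
    2^j×1#≉0# 1+1≉0 (suc j) = *-nonZero 2×1≉0 (2^j×1#≉0# 1+1≉0 j) ∘ trans (sym (×1-homo-* 2 (2 ℕ.^ j)))
      where
      2×1≉0 : ¬ (2 × 1# ≈ 0#)
      2×1≉0 = 1+1≉0 ∘ trans (+-congˡ (sym (+-identityʳ 1#)))

    module FiniteField {n} (card : HasCardinality n R) where
      enum : Fin n → Carrier
      enum = proj₁ card

      enum-injective : ∀ i j → enum i ≈ enum j → i ≡ j
      enum-injective = proj₁ (proj₂ card)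

      index : Carrier → Fin n
      index x = proj₁ (proj₂ (proj₂ card) x)

      enum-index : ∀ x → enum (index x) ≈ x
      enum-index x = proj₂ (proj₂ (proj₂ card) x)

      _≟_ : ∀ x y → Dec (x ≈ y)
      x ≟ y with index x ≟ᶠ index y
      ... | yes i≡j = yes (trans (sym (enum-index x)) (trans (reflexive (≡.cong enum i≡j)) (enum-index y)))
      ... | no i≢j = no (λ x≈y → i≢j (enum-injective _ _ (trans (enum-index x) (trans x≈y (sym (enum-index y))))))

      inverses⇒permutation : (φ ψ : Carrier → Carrier) →
                             (∀ {x y} → x ≈ y → φ x ≈ φ y) → (∀ {x y} → x ≈ y → ψ x ≈ ψ y) →
                             (∀ x → φ (ψ x) ≈ x) → (∀ x → ψ (φ x) ≈ x) → Permutation n n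
      inverses⇒permutation φ ψ φ-cong ψ-cong φψ≈id ψφ≈id = permutation (transport φ) (transport ψ)
        (λ i → enum-injective _ _ (trans (enum-index _) (trans (φ-cong (enum-index _)) (φψ≈id (enum i)))))
        (λ i → enum-injective _ _ (trans (enum-index _) (trans (ψ-cong (enum-index _)) (ψφ≈id (enum i)))))
        where
        transport : (Carrier → Carrier) → Fin n → Fin n
        transport χ i = index (χ (enum i))

      n×1#≈0# : n × 1# ≈ 0#
      n×1#≈0# = +-identityʳ-unique (∑ enum) (n × 1#) (sym (begin
        ∑ enum                                  ≈⟨ sum-permute enum translation ⟩
        ∑ (λ i → enum (index (enum i + 1#)))   ≈⟨ sum-cong-≋ (λ i → enum-index (enum i + 1#)) ⟩
        ∑ (λ i → enum i + 1#)                  ≈⟨ ∑-distrib-+ enum (λ _ → 1#) ⟩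
        ∑ enum + ∑ {n} (λ _ → 1#)              ≈⟨ +-congˡ (sum-replicate n) ⟩
        ∑ enum + n × 1#                        ∎))
        where
        translation : Permutation n n
        translation = inverses⇒permutation (_+ 1#) (_- 1#) +-congʳ +-congʳ
          (λ x → trans (+-assoc x _ _) (trans (+-congˡ (-‿inverseˡ 1#)) (+-identityʳ x)))
          (λ x → trans (+-assoc x _ _) (trans (+-congˡ (-‿inverseʳ 1#)) (+-identityʳ x)))

      characteristic-two : ∀ j → n ≡ 2 ℕ.^ j → 1# + 1# ≈ 0#
      characteristic-two j n≡2^j with (1# + 1#) ≟ 0#
      ... | yes 1+1≈0 = 1+1≈0
      ... | no 1+1≉0 = ⊥-elim (2^j×1#≉0# 1+1≉0 j (≡.subst (λ m → m × 1# ≈ 0#) n≡2^j n×1#≈0#))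

      unitPart : Carrier → Carrier
      unitPart x with x ≟ 0#
      ... | yes _ = 1#
      ... | no _ = x

      unitPart-zero : ∀ {x} → x ≈ 0# → unitPart x ≈ 1#
      unitPart-zero {x} x≈0 with x ≟ 0#
      ... | yes _ = refl
      ... | no x≉0 = ⊥-elim (x≉0 x≈0)

      unitPart-nonZero : ∀ {x} → ¬ (x ≈ 0#) → unitPart x ≈ x
      unitPart-nonZero {x} x≉0 with x ≟ 0#
      ... | yes x≈0 = ⊥-elim (x≉0 x≈0)
      ... | no _ = refl

      unitPart≉0# : ∀ x → ¬ (unitPart x ≈ 0#)
      unitPart≉0# x with x ≟ 0#
      ... | yes _ = 0#≉1# ∘ sym
      ... | no x≉0 = x≉0

      unitPart-cong : ∀ {x y} → x ≈ y → unitPart x ≈ unitPart y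
      unitPart-cong {x} {y} x≈y = by-cases (x ≟ 0#)
        where
        by-cases : Dec (x ≈ 0#) → unitPart x ≈ unitPart y
        by-cases (yes x≈0) = trans (unitPart-zero x≈0) (sym (unitPart-zero (trans (sym x≈y) x≈0)))
        by-cases (no x≉0) = trans (unitPart-nonZero x≉0) (trans x≈y (sym (unitPart-nonZero (x≉0 ∘ trans x≈y))))

      -- Scaling by x ≉ 0 permutes the field and fixes 0, so it multiplies the product of all unit
      -- parts by xⁿ and, at the same time, by x alone (the factor at 0 stays 1).
      fermat : ∀ x → x ^ n ≈ x
      fermat x with x ≟ 0#
      ... | yes x≈0 = begin
        x ^ n   ≈⟨ ^-congˡ n x≈0 ⟩
        0# ^ n  ≈⟨ 0#^n≈0# n {{nonZeroIndex (index 0#)}} ⟩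
        0#      ≈⟨ x≈0 ⟨
        x       ∎
      ... | no x≉0 with inverse x x≉0
      ... | x⁻¹ , xx⁻¹≈1 = *-cancelʳ-nonZero (∏-nonZero units (unitPart≉0# ∘ enum)) (begin
        x ^ n * ∏ units                           ≈⟨ ∏-scale x units ⟨
        ∏ (λ i → x * units i)                     ≈⟨ sum-differAt *-commutativeMonoid _ _ z x at-z away-from-z ⟩
        x * ∏ (λ i → unitPart (x * enum i))       ≈⟨ *-congˡ (∏-cong-≋ (λ i → unitPart-cong (enum-index (x * enum i)))) ⟨
        x * ∏ (λ i → units (index (x * enum i)))  ≈⟨ *-congˡ (∏-permute units scaling) ⟨
        x * ∏ units                               ∎)
        where
        units : Fin n → Carrier
        units = unitPart ∘ enum

        z : Fin n
        z = index 0#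

        scaling : Permutation n n
        scaling = inverses⇒permutation (x *_) (x⁻¹ *_) *-congˡ *-congˡ
          (λ y → trans (sym (*-assoc x x⁻¹ y)) (trans (*-congʳ xx⁻¹≈1) (*-identityˡ y)))
          (λ y → trans (sym (*-assoc x⁻¹ x y)) (trans (*-congʳ (trans (*-comm x⁻¹ x) xx⁻¹≈1)) (*-identityˡ y)))

        at-z : x * units z ≈ x * unitPart (x * enum z)
        at-z = *-congˡ (trans (unitPart-zero (enum-index 0#))
                              (sym (unitPart-zero (trans (*-congˡ (enum-index 0#)) (zeroʳ x)))))

        away-from-z : ∀ i → i ≢ z → x * units i ≈ unitPart (x * enum i)
        away-from-z i i≢z = trans (*-congˡ (unitPart-nonZero enum-i≉0))
                                  (sym (unitPart-nonZero (*-nonZero x≉0 enum-i≉0)))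
          where
          enum-i≉0 : ¬ (enum i ≈ 0#)
          enum-i≉0 enum-i≈0 = i≢z (enum-injective _ _ (trans enum-i≈0 (sym (enum-index 0#))))

  form : Carrier → Carrier → Carrier → Carrier → Carrier → Carrier → Carrier
  form c d y₀ y₁ y₂ y₃ = c * y₀ + d * y₁ + (c + 1#) * y₂ + d * y₃

  form-cong : ∀ {c d d′ y₀ y₁ y₂ y₃ z₀ z₁ z₂ z₃} → d ≈ d′ →
              y₀ ≈ z₀ → y₁ ≈ z₁ → y₂ ≈ z₂ → y₃ ≈ z₃ → form c d y₀ y₁ y₂ y₃ ≈ form c d′ z₀ z₁ z₂ z₃
  form-cong d≈d′ y₀≈z₀ y₁≈z₁ y₂≈z₂ y₃≈z₃ =
    +-cong (+-cong (+-cong (*-congˡ y₀≈z₀) (*-cong d≈d′ y₁≈z₁)) (*-congˡ y₂≈z₂)) (*-cong d≈d′ y₃≈z₃)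

  invMap≈form : ∀ q c d x → invMap R q c d x ≈ form c d x (x ^ q) ((x ^ q) ^ q) (((x ^ q) ^ q) ^ q)
  invMap≈form q c d x = form-cong refl refl refl (sym (^-assocʳ x q q)) (begin
    x ^ (q ℕ.* q ℕ.* q)  ≈⟨ ^-assocʳ x (q ℕ.* q) q ⟨
    (x ^ (q ℕ.* q)) ^ q  ≈⟨ ^-congˡ q (^-assocʳ x q q) ⟨
    ((x ^ q) ^ q) ^ q    ∎)

  module Characteristic2 (1+1≈0 : 1# + 1# ≈ 0#) where
    x+[1+1]y≈x : ∀ x y → x + (1# + 1#) * y ≈ x
    x+[1+1]y≈x x y = begin
      x + (1# + 1#) * y  ≈⟨ +-congˡ (*-congʳ 1+1≈0) ⟩
      x + 0# * y         ≈⟨ +-congˡ (zeroˡ y) ⟩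
      x + 0#             ≈⟨ +-identityʳ x ⟩
      x                  ∎

    ^2-distrib-+ : ∀ x y → (x + y) ^ 2 ≈ x ^ 2 + y ^ 2
    ^2-distrib-+ x y = begin
      (x + y) ^ 2
        ≈⟨ solve 2 (λ x y → (x :+ y) :* ((x :+ y) :* con 1)
                     := (x :* (x :* con 1) :+ y :* (y :* con 1)) :+ (con 1 :+ con 1) :* (x :* y))
                   refl x y ⟩
      x ^ 2 + y ^ 2 + (1# + 1#) * (x * y)  ≈⟨ x+[1+1]y≈x _ _ ⟩
      x ^ 2 + y ^ 2                        ∎

    ^2^j-distrib-+ : ∀ j x y → (x + y) ^ (2 ℕ.^ j) ≈ x ^ (2 ℕ.^ j) + y ^ (2 ℕ.^ j)
    ^2^j-distrib-+ ℕ.zero x y = distribʳ 1# x y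
    ^2^j-distrib-+ (suc j) x y = begin
      (x + y) ^ (2 ℕ.* 2^j)               ≈⟨ ^-assocʳ (x + y) 2 2^j ⟨
      ((x + y) ^ 2) ^ 2^j                 ≈⟨ ^-congˡ 2^j (^2-distrib-+ x y) ⟩
      (x ^ 2 + y ^ 2) ^ 2^j               ≈⟨ ^2^j-distrib-+ j (x ^ 2) (y ^ 2) ⟩
      (x ^ 2) ^ 2^j + (y ^ 2) ^ 2^j       ≈⟨ +-cong (^-assocʳ x 2 2^j) (^-assocʳ y 2 2^j) ⟩
      x ^ (2 ℕ.* 2^j) + y ^ (2 ℕ.* 2^j)   ∎
      where 2^j = 2 ℕ.^ j

    form-form : ∀ c d d′ x₀ x₁ x₂ x₃ →
                form c d (form c d x₀ x₁ x₂ x₃) (form c d′ x₁ x₂ x₃ x₀)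
                         (form c d x₂ x₃ x₀ x₁) (form c d′ x₃ x₀ x₁ x₂) ≈ x₀
    form-form c d d′ x₀ x₁ x₂ x₃ = begin
      form c d (form c d x₀ x₁ x₂ x₃) (form c d′ x₁ x₂ x₃ x₀)
               (form c d x₂ x₃ x₀ x₁) (form c d′ x₃ x₀ x₁ x₂)
        ≈⟨ solve 7 (λ c d d′ x₀ x₁ x₂ x₃ →
             let form′ = λ c d y₀ y₁ y₂ y₃ → c :* y₀ :+ d :* y₁ :+ (c :+ con 1) :* y₂ :+ d :* y₃ in
             form′ c d (form′ c d x₀ x₁ x₂ x₃) (form′ c d′ x₁ x₂ x₃ x₀)
                       (form′ c d x₂ x₃ x₀ x₁) (form′ c d′ x₃ x₀ x₁ x₂)
             := x₀ :+ (con 1 :+ con 1) :*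
                  ((c :* c :+ c :+ d :* d′) :* x₀ :+ (c :* d :+ (c :+ con 1) :* d) :* x₁
                   :+ (c :* (c :+ con 1) :+ d :* d′) :* x₂ :+ (c :* d :+ d :* (c :+ con 1)) :* x₃))
           refl c d d′ x₀ x₁ x₂ x₃ ⟩
      x₀ + (1# + 1#) * _  ≈⟨ x+[1+1]y≈x x₀ _ ⟩
      x₀                  ∎

    module Frobenius (j : ℕ) where
      σ : Carrier → Carrier
      σ x = x ^ (2 ℕ.^ j)

      σ-cong : ∀ {x y} → x ≈ y → σ x ≈ σ y
      σ-cong = ^-congˡ (2 ℕ.^ j)

      σ-+ : ∀ x y → σ (x + y) ≈ σ x + σ y
      σ-+ = ^2^j-distrib-+ j

      σ-* : ∀ x y → σ (x * y) ≈ σ x * σ y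
      σ-* x y = ^-distrib-* x y (2 ℕ.^ j)

      σ-1 : σ 1# ≈ 1#
      σ-1 = 1#^n≈1# (2 ℕ.^ j)

    module Semilinear (σ : Carrier → Carrier)
                      (σ-cong : ∀ {x y} → x ≈ y → σ x ≈ σ y)
                      (σ-+ : ∀ x y → σ (x + y) ≈ σ x + σ y)
                      (σ-* : ∀ x y → σ (x * y) ≈ σ x * σ y)
                      (σ-1 : σ 1# ≈ 1#)
                      (σ⁴≈id : ∀ x → σ (σ (σ (σ x))) ≈ x)
                      {C D : Carrier} (σC≈C : σ C ≈ C) (σ²D≈D : σ (σ D) ≈ D) where
      L : Carrier → Carrier
      L x = form C D x (σ x) (σ (σ x)) (σ (σ (σ x)))

      L-cong : ∀ {x y} → x ≈ y → L x ≈ L y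
      L-cong x≈y = form-cong refl x≈y (σ-cong x≈y) (σ-cong (σ-cong x≈y)) (σ-cong (σ-cong (σ-cong x≈y)))

      σ-form : ∀ d y₀ y₁ y₂ y₃ → σ (form C d y₀ y₁ y₂ y₃) ≈ form C (σ d) (σ y₀) (σ y₁) (σ y₂) (σ y₃)
      σ-form d y₀ y₁ y₂ y₃ = begin
        σ (C * y₀ + d * y₁ + (C + 1#) * y₂ + d * y₃)
          ≈⟨ trans (σ-+ _ _) (+-congʳ (trans (σ-+ _ _) (+-congʳ (σ-+ _ _)))) ⟩
        σ (C * y₀) + σ (d * y₁) + σ ((C + 1#) * y₂) + σ (d * y₃)
          ≈⟨ +-cong (+-cong (+-cong (σ-* C y₀) (σ-* d y₁)) (σ-* (C + 1#) y₂)) (σ-* d y₃) ⟩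
        σ C * σ y₀ + σ d * σ y₁ + σ (C + 1#) * σ y₂ + σ d * σ y₃
          ≈⟨ +-congʳ (+-cong (+-congʳ (*-congʳ σC≈C)) (*-congʳ (trans (σ-+ C 1#) (+-cong σC≈C σ-1)))) ⟩
        C * σ y₀ + σ d * σ y₁ + (C + 1#) * σ y₂ + σ d * σ y₃  ∎

      L-involutive : ∀ x → L (L x) ≈ x
      L-involutive x = begin
        L (L x)                                           ≡⟨⟩
        form C D (L x) (σ (L x)) (σ (σ (L x))) (σ (σ (σ (L x))))
          ≈⟨ form-cong refl refl σL σ²L σ³L ⟩
        form C D (L x) (form C D′ x₁ x₂ x₃ x) (form C D x₂ x₃ x x₁) (form C D′ x₃ x x₁ x₂)
          ≈⟨ form-form C D D′ x x₁ x₂ x₃ ⟩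
        x                                                 ∎
        where
        x₁ x₂ x₃ D′ : Carrier
        x₁ = σ x
        x₂ = σ x₁
        x₃ = σ x₂
        D′ = σ D

        σL : σ (L x) ≈ form C D′ x₁ x₂ x₃ x
        σL = trans (σ-form D x x₁ x₂ x₃) (form-cong refl refl refl refl (σ⁴≈id x))

        σ²L : σ (σ (L x)) ≈ form C D x₂ x₃ x x₁
        σ²L = trans (σ-cong σL) (trans (σ-form D′ x₁ x₂ x₃ x) (form-cong σ²D≈D refl refl (σ⁴≈id x) refl))

        σ³L : σ (σ (σ (L x))) ≈ form C D′ x₃ x x₁ x₂
        σ³L = trans (σ-cong σ²L) (trans (σ-form D x₂ x₃ x x₁) (form-cong refl refl (σ⁴≈id x) refl refl))

open import Data.Nat using (_^_)

mainTheorem6 : ∀ {c ℓ} (k : ℕ) (R : CommutativeRing c ℓ) →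
               IsField R → HasCardinality ((2 ^ suc k) ^ 4) R →
               ∀ (C D : CommutativeRing.Carrier R) →
               CommutativeRing._≈_ R (Pow._^_ R C (2 ^ suc k)) C →
               CommutativeRing._≈_ R (Pow._^_ R D ((2 ^ suc k) ^ 2)) D →
               ∀ x → CommutativeRing._≈_ R (invMap R (2 ^ suc k) C D (invMap R (2 ^ suc k) C D x)) x
mainTheorem6 k R isField card C D C^q≈C D^q²≈D x = begin
  f (f x)  ≈⟨ invMap≈form R q C D (f x) ⟩
  L (f x)  ≈⟨ L-cong (invMap≈form R q C D x) ⟩
  L (L x)  ≈⟨ L-involutive x ⟩
  x        ∎
  where
  open CommutativeRing R using (Carrier; _≈_; _+_; 0#; 1#; setoid; trans)
  open SetoidReasoning setoid
  open Field R isField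
  open FiniteField card

  q : ℕ
  q = 2 ^ suc k

  f : Carrier → Carrier
  f = invMap R q C D

  1+1≈0 : 1# + 1# ≈ 0#
  1+1≈0 = characteristic-two (suc k ℕ.* 4) (ℕ.^-*-assoc 2 (suc k) 4)

  open Characteristic2 R 1+1≈0
  open Frobenius (suc k)

  σ⁴≈id : ∀ y → σ (σ (σ (σ y))) ≈ y
  σ⁴≈id y = trans (iterate-^ R q 4 y) (fermat y)

  open Semilinear σ σ-cong σ-+ σ-* σ-1 σ⁴≈id C^q≈C (trans (iterate-^ R q 2 D) D^q²≈D)
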